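{- Let $t,\lambda$ be integers with $\lambda \ge t \ge 2$, and let $D$ be a two-way $(t,\lambda)$-liking digraph of order $n$. Then $D$ is $k$-diregular for a positive integer $k$ satisfying \[\binom{n-1}{t-1}\binom{\lambda}{t} = \binom{k}{t}\binom{\lambda-1}{t-1}.\]
   Context: All digraphs are finite, with no loops and no multiple arcs. For positive integers $t$ and $\lambda$, a digraph is a two-way $(t,\lambda)$-liking digraph if every set of $t$ distinct vertices has exactly $\lambda$ common out-neighbors and exactly $\lambda$ common in-neighbors. A digraph is $k$-diregular (for a positive integer $k$) if every vertex has outdegree $k$ and indegree $k$. -}

module Defs where

open import Data.Bool using (Bool; true; false; _∧_; _∨_; not)
open import Data.Nat using (ℕ; suc)
open import Data.Fin using (Fin)
open import Data.Fin.Subset using (Subset; ∣_∣; _∈_)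
open import Data.Vec using (Vec; tabulate; lookup; foldr; allFin)
open import Relation.Binary.PropositionalEquality using (_≡_)

-- A digraph on vertex set Fin n: adjacency as a Boolean relation
-- (arc u → v iff adj u v ≡ true); a relation rules out multiple arcs.
record Digraph (n : ℕ) : Set where
  field
    adj     : Fin n → Fin n → Bool
    noLoops : ∀ v → adj v v ≡ false
open Digraph public

allIn : ∀ {n} → Subset n → (Fin n → Bool) → Bool
allIn {n} S P = foldr _ (λ u b → (not (lookup S u) ∨ P u) ∧ b) true (allFin n)

commonOut : ∀ {n} → Digraph n → Subset n → Subset n
commonOut D S = tabulate (λ v → allIn S (λ u → adj D u v))

commonIn : ∀ {n} → Digraph n → Subset n → Subset n
commonIn D S = tabulate (λ v → allIn S (λ u → adj D v u))

outNbrs : ∀ {n} → Digraph n → Fin n → Subset n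
outNbrs D u = tabulate (λ v → adj D u v)

inNbrs : ∀ {n} → Digraph n → Fin n → Subset n
inNbrs D u = tabulate (λ v → adj D v u)

TwoWayLiking : ∀ {n} → ℕ → ℕ → Digraph n → Set
TwoWayLiking t l D = ∀ S → ∣ S ∣ ≡ t →
  (∣ commonOut D S ∣ ≡ l) Data.Product.× (∣ commonIn D S ∣ ≡ l)
  where import Data.Product

Diregular : ∀ {n} → ℕ → Digraph n → Set
Diregular k D = ∀ v → (∣ outNbrs D v ∣ ≡ k) Data.Product.× (∣ inNbrs D v ∣ ≡ k)
  where import Data.Product

-- Downward induction on s. Suppose every (s+1)-set has exactly a common out-neighbours and
-- exactly a common in-neighbours, and let U be an s-set. Counting the pairs (u, X) with
-- u ∉ U and X an (s+1)-subset of N⁺(U ∪ {u}) first by u and then by X gives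
-- (n − s)·C(a, s+1) = C(|N⁺(U)|, s+1)·(a − s). The left side is positive and does not
-- depend on U, and b ↦ C(b, s+1) is injective where it is positive, so |N⁺(U)| is the
-- same b > s for every s-set U. Reversing all arcs gives the same for N⁻(U). At s = 1 this
-- is k-diregularity. The same count with U = ∅ and |X| = t gives n·C(k, t) = C(n, t)·λ,
-- and the absorption identity n·C(n−1, t−1) = t·C(n, t), used for n and for λ, turns this
-- into the stated identity.
module Submission where

open import Defs
open import Data.Nat using (ℕ; _≤_; _∸_; _*_; _>_)
open import Data.Nat.Combinatorics using (_C_)
open import Data.Product using (Σ; _×_)
open import Relation.Binary.PropositionalEquality using (_≡_)

open import Data.Bool using (Bool; true; false; not; _∧_; _∨_; T; if_then_else_)
open import Data.Bool.Properties using (T-≡; T-∧)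
open import Data.Fin using (Fin; zero; suc)
open import Data.Fin.Subset using (Subset; outside; inside; ∣_∣; _∈_; _∉_; _⊆_; ⊥; ⊤; ⁅_⁆; ∁; _∩_; _∪_)
open import Data.Fin.Subset.Properties
  using ( _∈?_; _⊆?_; ∉⊥; ⊆⊤; ⊆-antisym; drop-∷-⊆; p⊆q⇒∣p∣≤∣q∣; p∩q⊆p; p∩q⊆q; x∈p∩q⁺; x∈p∩q⁻
        ; x∈p∪q⁺; x∈p∪q⁻; x∈⁅x⁆; x∈⁅y⁆⇒x≡y; x∈∁p⇒x∉p; ∪-identityˡ; ∪-identityʳ; ∩-identityˡ
        ; ∣⊥∣≡0; ∣⊤∣≡n; ∣⁅x⁆∣≡1; ∣∁p∣≡n∸∣p∣ )
open import Data.Nat using (zero; suc; _+_; _<_; s≤s; z<s; _≟_; >-nonZero)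
open import Data.Nat.Combinatorics using (nCk+nC[k+1]≡[n+1]C[k+1]; nC1≡n; k>n⇒nCk≡0)
open import Data.Nat.Properties
  using ( ≤-trans; ≤-reflexive; <-trans; <-≤-trans; <⇒≤; <⇒≢; >⇒≢; ≮⇒≥; <-cmp; m≤n⇒m<n∨m≡n
        ; m≤m+n; m<n+m; m<n⇒0<n∸m; n>0⇒n≢0; *-mono-<; +-∸-assoc
        ; +-assoc; +-comm; +-identityʳ; *-comm; *-identityˡ; *-identityʳ; *-zeroʳ; *-distribˡ-+
        ; *-cancelˡ-≡; *-cancelʳ-≡; +-commutativeSemigroup; *-commutativeSemigroup; +-*-semiring )
open import Data.Product using (_,_; proj₁; proj₂; swap)
open import Data.Sum using (inj₁; inj₂)
open import Data.Vec using (Vec; []; _∷_; here; there; lookup; tabulate; foldr; allFin)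
open import Data.Vec.Properties using ([]=⇒lookup; lookup⇒[]=; lookup∘tabulate)
open import Data.Vec.Relation.Unary.All using (All; []; _∷_)
open import Data.Vec.Relation.Unary.All.Properties using (tabulate⁺; tabulate⁻)
open import Function.Base using (_∘_)
open import Function.Bundles using (_⇔_; mk⇔; Equivalence)
open import Function.Properties.Equivalence using () renaming (trans to ⇔-trans)
open import Relation.Binary.Definitions using (tri<; tri≈; tri>)
open import Relation.Binary.PropositionalEquality
  using (_≗_; refl; sym; trans; cong; cong₂; subst; module ≡-Reasoning)
open import Relation.Nullary.Decidable using (Dec; does; _because_; yes; no; _×-dec_)
open import Relation.Nullary.Negation using (contradiction)

open import Algebra.Properties.CommutativeSemigroup +-commutativeSemigroup
  using () renaming (interchange to +-interchange)
open import Algebra.Properties.CommutativeSemigroup *-commutativeSemigroup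
  using () renaming (interchange to *-interchange)
open import Algebra.Properties.Semiring.Sum +-*-semiring
  using (sum-syntax; sum-cong-≗; *-distribˡ-sum; *-distribʳ-sum)

open Equivalence using (to; from)

private
  variable
    k m n s t l : ℕ

k≤n⇒nCk>0 : k ≤ n → n C k > 0
k≤n⇒nCk>0 {zero}          _          = z<s
k≤n⇒nCk>0 {suc k} {suc n} (s≤s k≤n) =
  <-≤-trans (k≤n⇒nCk>0 k≤n) (≤-trans (m≤m+n (n C k) _) (≤-reflexive (nCk+nC[k+1]≡[n+1]C[k+1] n k)))

nC[1+k]<[1+n]C[1+k] : k ≤ n → n C suc k < suc n C suc k
nC[1+k]<[1+n]C[1+k] {k} {n} k≤n =
  <-≤-trans (m<n+m (n C suc k) (k≤n⇒nCk>0 k≤n)) (≤-reflexive (nCk+nC[k+1]≡[n+1]C[k+1] n k))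

C-strictMonoˡ : k ≤ m → m < n → m C suc k < n C suc k
C-strictMonoˡ {n = suc n} k≤m (s≤s m≤n) with m≤n⇒m<n∨m≡n m≤n
... | inj₁ m<n  = <-trans (C-strictMonoˡ k≤m m<n) (nC[1+k]<[1+n]C[1+k] (≤-trans k≤m (<⇒≤ m<n)))
... | inj₂ refl = nC[1+k]<[1+n]C[1+k] k≤m

C-injectiveˡ : k ≤ m → k ≤ n → m C suc k ≡ n C suc k → m ≡ n
C-injectiveˡ {m = m} {n} k≤m k≤n eq with <-cmp m n
... | tri< m<n _ _ = contradiction eq (<⇒≢ (C-strictMonoˡ k≤m m<n))
... | tri≈ _ m≡n _ = m≡n
... | tri> _ _ n<m = contradiction eq (>⇒≢ (C-strictMonoˡ k≤n n<m))

[1+n]*nCk≡[1+k]*[1+n]C[1+k] : ∀ n k → suc n * (n C k) ≡ suc k * (suc n C suc k)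
[1+n]*nCk≡[1+k]*[1+n]C[1+k] zero    zero    = refl
[1+n]*nCk≡[1+k]*[1+n]C[1+k] zero    (suc k) = sym (*-zeroʳ (suc (suc k)))
[1+n]*nCk≡[1+k]*[1+n]C[1+k] (suc n) zero    =
  trans (*-identityʳ (suc (suc n))) (sym (trans (*-identityˡ _) (nC1≡n (suc (suc n)))))
[1+n]*nCk≡[1+k]*[1+n]C[1+k] (suc n) (suc k) = begin
  suc (suc n) * Y                              ≡⟨⟩
  Y + suc n * Y                                ≡⟨ cong (λ z → Y + suc n * z) (nCk+nC[k+1]≡[n+1]C[k+1] n k) ⟨
  Y + suc n * (n C k + n C suc k)              ≡⟨ cong (Y +_) (*-distribˡ-+ (suc n) (n C k) _) ⟩
  Y + (suc n * (n C k) + suc n * (n C suc k))  ≡⟨ cong (Y +_) (cong₂ _+_ ([1+n]*nCk≡[1+k]*[1+n]C[1+k] n k)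
                                                                          ([1+n]*nCk≡[1+k]*[1+n]C[1+k] n (suc k))) ⟩
  Y + (suc k * Y + suc (suc k) * Z)            ≡⟨ +-assoc Y (suc k * Y) _ ⟨
  suc (suc k) * Y + suc (suc k) * Z            ≡⟨ *-distribˡ-+ (suc (suc k)) Y Z ⟨
  suc (suc k) * (Y + Z)                        ≡⟨ cong (suc (suc k) *_) (nCk+nC[k+1]≡[n+1]C[k+1] (suc n) (suc k)) ⟩
  suc (suc k) * (suc (suc n) C suc (suc k))    ∎
  where
  open ≡-Reasoning
  Y = suc n C suc k
  Z = suc n C suc (suc k)

n*kCt≡nCt*l⇒[n∸1]C[t∸1]*lCt≡kCt*[l∸1]C[t∸1] : ∀ k → 0 < n → 0 < t → 0 < l →
  n * (k C t) ≡ (n C t) * l → ((n ∸ 1) C (t ∸ 1)) * (l C t) ≡ (k C t) * ((l ∸ 1) C (t ∸ 1))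
n*kCt≡nCt*l⇒[n∸1]C[t∸1]*lCt≡kCt*[l∸1]C[t∸1] {suc n} {suc t} {suc l} k z<s z<s z<s counted =
  *-cancelˡ-≡ _ _ (suc n * suc l) (begin
    suc n * suc l * ((n C t) * Y)   ≡⟨ *-interchange (suc n) (suc l) (n C t) Y ⟩
    suc n * (n C t) * (suc l * Y)   ≡⟨ cong (_* (suc l * Y)) ([1+n]*nCk≡[1+k]*[1+n]C[1+k] n t) ⟩
    suc t * X * (suc l * Y)         ≡⟨ cong (_* (suc l * Y)) (*-comm (suc t) X) ⟩
    X * suc t * (suc l * Y)         ≡⟨ *-interchange X (suc t) (suc l) Y ⟩
    X * suc l * (suc t * Y)         ≡⟨ cong₂ _*_ counted ([1+n]*nCk≡[1+k]*[1+n]C[1+k] l t) ⟨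
    suc n * K * (suc l * (l C t))   ≡⟨ *-interchange (suc n) K (suc l) (l C t) ⟩
    suc n * suc l * (K * (l C t))   ∎)
  where
  open ≡-Reasoning
  X = suc n C suc t
  Y = suc l C suc t
  K = k C suc t

𝟙 : {P : Set} → Dec P → ℕ
𝟙 P? = if does P? then 1 else 0

𝟙-cong : {P Q : Set} → P ⇔ Q → (P? : Dec P) (Q? : Dec Q) → 𝟙 P? ≡ 𝟙 Q?
𝟙-cong P⇔Q (yes _) (yes _) = refl
𝟙-cong P⇔Q (no _)  (no _)  = refl
𝟙-cong P⇔Q (yes p) (no ¬q) = contradiction (to P⇔Q p) ¬q
𝟙-cong P⇔Q (no ¬p) (yes q) = contradiction (from P⇔Q q) ¬p

𝟙-×-dec : {P Q : Set} (P? : Dec P) (Q? : Dec Q) → 𝟙 (P? ×-dec Q?) ≡ 𝟙 P? * 𝟙 Q?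
𝟙-×-dec (true  because _) (true  because _) = refl
𝟙-×-dec (true  because _) (false because _) = refl
𝟙-×-dec (false because _) _                 = refl

𝟙*-cong : ∀ {P : Set} {a b} (P? : Dec P) → (P → a ≡ b) → 𝟙 P? * a ≡ 𝟙 P? * b
𝟙*-cong (yes p) a≡b = cong (1 *_) (a≡b p)
𝟙*-cong (no _)  _   = refl

∣p∣≡∑𝟙∈ : (p : Subset n) → ∣ p ∣ ≡ ∑[ u < n ] 𝟙 (u ∈? p)
∣p∣≡∑𝟙∈ []            = refl
∣p∣≡∑𝟙∈ (inside  ∷ p) = cong suc (∣p∣≡∑𝟙∈ p)
∣p∣≡∑𝟙∈ (outside ∷ p) = ∣p∣≡∑𝟙∈ p

sumSubsets : (Subset n → ℕ) → ℕ
sumSubsets {zero}  f = f []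
sumSubsets {suc n} f = sumSubsets (λ X → f (outside ∷ X)) + sumSubsets (λ X → f (inside ∷ X))

sumSubsets-cong : {f g : Subset n → ℕ} → f ≗ g → sumSubsets f ≡ sumSubsets g
sumSubsets-cong {zero}  f≗g = f≗g []
sumSubsets-cong {suc n} f≗g =
  cong₂ _+_ (sumSubsets-cong (λ X → f≗g (outside ∷ X))) (sumSubsets-cong (λ X → f≗g (inside ∷ X)))

sumSubsets-zero : ∀ n → sumSubsets {n} (λ _ → 0) ≡ 0
sumSubsets-zero zero    = refl
sumSubsets-zero (suc n) = cong₂ _+_ (sumSubsets-zero n) (sumSubsets-zero n)

sumSubsets-distrib-+ : (f g : Subset n → ℕ) → sumSubsets (λ X → f X + g X) ≡ sumSubsets f + sumSubsets g
sumSubsets-distrib-+ {zero}  f g = refl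
sumSubsets-distrib-+ {suc n} f g = trans
  (cong₂ _+_ (sumSubsets-distrib-+ (λ X → f (outside ∷ X)) (λ X → g (outside ∷ X)))
             (sumSubsets-distrib-+ (λ X → f (inside ∷ X)) (λ X → g (inside ∷ X))))
  (+-interchange (sumSubsets (λ X → f (outside ∷ X))) _ (sumSubsets (λ X → f (inside ∷ X))) _)

*-distribˡ-sumSubsets : ∀ c (f : Subset n → ℕ) → c * sumSubsets f ≡ sumSubsets (λ X → c * f X)
*-distribˡ-sumSubsets {zero}  c f = refl
*-distribˡ-sumSubsets {suc n} c f = trans (*-distribˡ-+ c _ _)
  (cong₂ _+_ (*-distribˡ-sumSubsets c (λ X → f (outside ∷ X)))
             (*-distribˡ-sumSubsets c (λ X → f (inside ∷ X))))

*-distribʳ-sumSubsets : ∀ c (f : Subset n → ℕ) → sumSubsets f * c ≡ sumSubsets (λ X → f X * c)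
*-distribʳ-sumSubsets c f =
  trans (*-comm _ c) (trans (*-distribˡ-sumSubsets c f) (sumSubsets-cong (λ X → *-comm c (f X))))

∑-sumSubsets-comm : (f : Fin m → Subset n → ℕ) →
  ∑[ u < m ] sumSubsets (f u) ≡ sumSubsets (λ X → ∑[ u < m ] f u X)
∑-sumSubsets-comm {zero}  {n} f = sym (sumSubsets-zero n)
∑-sumSubsets-comm {suc m}     f =
  trans (cong (sumSubsets (f zero) +_) (∑-sumSubsets-comm (λ u → f (suc u))))
        (sym (sumSubsets-distrib-+ (f zero) (λ X → ∑[ u < m ] f (suc u) X)))

sumSubsets-ofSize≡C : (B : Subset n) (m : ℕ) →
  sumSubsets (λ X → 𝟙 ((X ⊆? B) ×-dec (∣ X ∣ ≟ m))) ≡ ∣ B ∣ C m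
sumSubsets-ofSize≡C []            zero    = refl
sumSubsets-ofSize≡C []            (suc m) = refl
sumSubsets-ofSize≡C {suc n} (outside ∷ B) m =
  trans (cong₂ _+_ (sumSubsets-ofSize≡C B m) (sumSubsets-zero n)) (+-identityʳ _)
sumSubsets-ofSize≡C {suc n} (inside ∷ B) zero = cong₂ _+_ (sumSubsets-ofSize≡C B zero)
  (trans (sumSubsets-cong (λ X → trans (𝟙-×-dec (X ⊆? B) (suc ∣ X ∣ ≟ 0)) (*-zeroʳ (𝟙 (X ⊆? B)))))
         (sumSubsets-zero n))
sumSubsets-ofSize≡C (inside ∷ B) (suc m) =
  trans (cong₂ _+_ (sumSubsets-ofSize≡C B (suc m)) (sumSubsets-ofSize≡C B m))
        (trans (+-comm (∣ B ∣ C suc m) _) (nCk+nC[k+1]≡[n+1]C[k+1] ∣ B ∣ m))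

⊆-∩⇔ : {X p q : Subset n} → X ⊆ p ∩ q ⇔ (X ⊆ p × X ⊆ q)
⊆-∩⇔ {X = X} {p} {q} = mk⇔ split join
  where
  split : X ⊆ p ∩ q → X ⊆ p × X ⊆ q
  split X⊆p∩q = p∩q⊆p p q ∘ X⊆p∩q , p∩q⊆q p q ∘ X⊆p∩q
  join : X ⊆ p × X ⊆ q → X ⊆ p ∩ q
  join (X⊆p , X⊆q) x∈X = x∈p∩q⁺ (X⊆p x∈X , X⊆q x∈X)

∣∁q∩p∣≡∣p∣∸∣q∣ : {p q : Subset n} → q ⊆ p → ∣ ∁ q ∩ p ∣ ≡ ∣ p ∣ ∸ ∣ q ∣
∣∁q∩p∣≡∣p∣∸∣q∣ {p = []}          {[]}          _   = refl
∣∁q∩p∣≡∣p∣∸∣q∣ {p = inside  ∷ p} {inside  ∷ q} q⊆p = ∣∁q∩p∣≡∣p∣∸∣q∣ (drop-∷-⊆ q⊆p)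
∣∁q∩p∣≡∣p∣∸∣q∣ {p = inside  ∷ p} {outside ∷ q} q⊆p =
  trans (cong suc (∣∁q∩p∣≡∣p∣∸∣q∣ (drop-∷-⊆ q⊆p))) (sym (+-∸-assoc 1 (p⊆q⇒∣p∣≤∣q∣ (drop-∷-⊆ q⊆p))))
∣∁q∩p∣≡∣p∣∸∣q∣ {p = outside ∷ p} {outside ∷ q} q⊆p = ∣∁q∩p∣≡∣p∣∸∣q∣ (drop-∷-⊆ q⊆p)
∣∁q∩p∣≡∣p∣∸∣q∣ {p = outside ∷ p} {inside  ∷ q} q⊆p with q⊆p here
... | ()

∣p∪⁅x⁆∣≡1+∣p∣ : {p : Subset n} {x : Fin n} → x ∉ p → ∣ p ∪ ⁅ x ⁆ ∣ ≡ suc ∣ p ∣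
∣p∪⁅x⁆∣≡1+∣p∣ {p = outside ∷ p} {zero}  _   = cong (suc ∘ ∣_∣) (∪-identityʳ p)
∣p∪⁅x⁆∣≡1+∣p∣ {p = inside  ∷ p} {zero}  x∉p = contradiction here x∉p
∣p∪⁅x⁆∣≡1+∣p∣ {p = outside ∷ p} {suc x} x∉p = ∣p∪⁅x⁆∣≡1+∣p∣ (x∉p ∘ there)
∣p∪⁅x⁆∣≡1+∣p∣ {p = inside  ∷ p} {suc x} x∉p = cong suc (∣p∪⁅x⁆∣≡1+∣p∣ (x∉p ∘ there))

subsetOfSize : ∀ s → s ≤ n → Σ (Subset n) (λ S → ∣ S ∣ ≡ s)
subsetOfSize {n} zero    _         = ⊥ , ∣⊥∣≡0 n
subsetOfSize     (suc s) (s≤s s≤n) = let S , ∣S∣≡s = subsetOfSize s s≤n in inside ∷ S , cong suc ∣S∣≡s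

T-foldr-∧ : ∀ {A : Set} {m} (f : A → Bool) (xs : Vec A m) →
  T (foldr (λ _ → Bool) (λ x b → f x ∧ b) true xs) ⇔ All (T ∘ f) xs
T-foldr-∧ f []       = mk⇔ (λ _ → []) (λ _ → _)
T-foldr-∧ f (x ∷ xs) = mk⇔
  (λ T[fx∧r] → let T[fx] , T[r] = to T-∧ T[fx∧r] in T[fx] ∷ to (T-foldr-∧ f xs) T[r])
  (λ { (T[fx] ∷ T[f]xs) → from T-∧ (T[fx] , from (T-foldr-∧ f xs) T[f]xs) })

T-not-∨ : ∀ {a b} → T (not a ∨ b) ⇔ (T a → T b)
T-not-∨ {true}  = mk⇔ (λ T[b] _ → T[b]) (λ T[a]→T[b] → T[a]→T[b] _)
T-not-∨ {false} = mk⇔ (λ _ ()) (λ _ → _)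

∈⇔T-lookup : {p : Subset n} {x : Fin n} → x ∈ p ⇔ T (lookup p x)
∈⇔T-lookup {p = p} {x} = mk⇔ (from T-≡ ∘ []=⇒lookup) (lookup⇒[]= x p ∘ to T-≡)

∈-tabulate : {f : Fin n → Bool} {x : Fin n} → x ∈ tabulate f ⇔ T (f x)
∈-tabulate {f = f} {x} = mk⇔ (subst T (lookup∘tabulate f x) ∘ to ∈⇔T-lookup)
                             (from ∈⇔T-lookup ∘ subst T (sym (lookup∘tabulate f x)))

T-allIn : (S : Subset n) (P : Fin n → Bool) → T (allIn S P) ⇔ (∀ {u} → u ∈ S → T (P u))
T-allIn {n} S P = mk⇔ sound complete
  where
  T-allIn⇔All : T (allIn S P) ⇔ All (λ u → T (not (lookup S u) ∨ P u)) (allFin n)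
  T-allIn⇔All = T-foldr-∧ (λ u → not (lookup S u) ∨ P u) (allFin n)
  sound : T (allIn S P) → ∀ {u} → u ∈ S → T (P u)
  sound T[allIn] {u} u∈S = to T-not-∨ (tabulate⁻ (to T-allIn⇔All T[allIn]) u) (to ∈⇔T-lookup u∈S)
  complete : (∀ {u} → u ∈ S → T (P u)) → T (allIn S P)
  complete P[S] = from T-allIn⇔All (tabulate⁺ λ u → from T-not-∨ (P[S] ∘ from ∈⇔T-lookup))

-- commonIn D and inNbrs D are definitionally commonOut (reverse D) and outNbrs (reverse D),
-- so each fact about out-neighbourhoods also applies to in-neighbourhoods.
reverse : Digraph n → Digraph n
reverse D = record { adj = λ u v → adj D v u ; noLoops = noLoops D }

∈-commonOut : (D : Digraph n) {S : Subset n} {v : Fin n} →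
  v ∈ commonOut D S ⇔ (∀ {u} → u ∈ S → T (adj D u v))
∈-commonOut D {S} {v} = ⇔-trans ∈-tabulate (T-allIn S (λ u → adj D u v))

⊆-outNbrs⇔∈-commonIn : (D : Digraph n) {X : Subset n} {u : Fin n} → X ⊆ outNbrs D u ⇔ u ∈ commonIn D X
⊆-outNbrs⇔∈-commonIn D {X} {u} = mk⇔ into outof
  where
  into : X ⊆ outNbrs D u → u ∈ commonIn D X
  into X⊆ = from (∈-commonOut (reverse D)) (λ w∈X → to ∈-tabulate (X⊆ w∈X))
  outof : u ∈ commonIn D X → X ⊆ outNbrs D u
  outof u∈ w∈X = from ∈-tabulate (to (∈-commonOut (reverse D)) u∈ w∈X)

⊆-commonOut⇒⊆-commonIn : (D : Digraph n) {U X : Subset n} → X ⊆ commonOut D U → U ⊆ commonIn D X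
⊆-commonOut⇒⊆-commonIn D X⊆ u∈U = from (∈-commonOut (reverse D)) (λ w∈X → to (∈-commonOut D) (X⊆ w∈X) u∈U)

commonOut-⊥ : (D : Digraph n) → commonOut D ⊥ ≡ ⊤
commonOut-⊥ D = ⊆-antisym ⊆⊤ (λ _ → from (∈-commonOut D) (λ u∈⊥ → contradiction u∈⊥ ∉⊥))

commonOut-∪⁅⁆ : (D : Digraph n) (U : Subset n) (u : Fin n) →
  commonOut D (U ∪ ⁅ u ⁆) ≡ commonOut D U ∩ outNbrs D u
commonOut-∪⁅⁆ D U u = ⊆-antisym split join
  where
  split : commonOut D (U ∪ ⁅ u ⁆) ⊆ commonOut D U ∩ outNbrs D u
  split v∈ = x∈p∩q⁺ ( from (∈-commonOut D {S = U}) (λ w∈U → adjacent (x∈p∪q⁺ (inj₁ w∈U)))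
                    , from ∈-tabulate (adjacent (x∈p∪q⁺ (inj₂ (x∈⁅x⁆ u)))))
    where adjacent = to (∈-commonOut D {S = U ∪ ⁅ u ⁆}) v∈
  join : commonOut D U ∩ outNbrs D u ⊆ commonOut D (U ∪ ⁅ u ⁆)
  join {v} v∈ = from (∈-commonOut D) adjacent
    where
    adjacent : ∀ {w} → w ∈ U ∪ ⁅ u ⁆ → T (adj D w v)
    adjacent w∈ with x∈p∪q⁻ U ⁅ u ⁆ w∈
    ... | inj₁ w∈U   = to (∈-commonOut D) (proj₁ (x∈p∩q⁻ _ _ v∈)) w∈U
    ... | inj₂ w∈⁅u⁆ rewrite x∈⁅y⁆⇒x≡y u w∈⁅u⁆ = to ∈-tabulate (proj₂ (x∈p∩q⁻ _ _ v∈))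

commonOut-⁅⁆ : (D : Digraph n) (u : Fin n) → commonOut D ⁅ u ⁆ ≡ outNbrs D u
commonOut-⁅⁆ D u = begin
  commonOut D ⁅ u ⁆             ≡⟨ cong (commonOut D) (∪-identityˡ ⁅ u ⁆) ⟨
  commonOut D (⊥ ∪ ⁅ u ⁆)       ≡⟨ commonOut-∪⁅⁆ D ⊥ u ⟩
  commonOut D ⊥ ∩ outNbrs D u   ≡⟨ cong (_∩ outNbrs D u) (commonOut-⊥ D) ⟩
  ⊤ ∩ outNbrs D u               ≡⟨ ∩-identityˡ (outNbrs D u) ⟩
  outNbrs D u                   ∎
  where open ≡-Reasoning

OutLiking : ℕ → ℕ → Digraph n → Set
OutLiking t l D = ∀ S → ∣ S ∣ ≡ t → ∣ commonOut D S ∣ ≡ l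

TwoWayLiking⇒OutLiking : (D : Digraph n) → TwoWayLiking t l D → OutLiking t l D
TwoWayLiking⇒OutLiking D liking S ∣S∣≡t = proj₁ (liking S ∣S∣≡t)

TwoWayLiking-reverse : (D : Digraph n) → TwoWayLiking t l D → TwoWayLiking t l (reverse D)
TwoWayLiking-reverse D liking S ∣S∣≡t = swap (liking S ∣S∣≡t)

TwoWayLiking⇒InLiking : (D : Digraph n) → TwoWayLiking t l D → OutLiking t l (reverse D)
TwoWayLiking⇒InLiking D = TwoWayLiking⇒OutLiking (reverse D) ∘ TwoWayLiking-reverse D

-- For a fixed X ⊆ N⁺(U), the vertices u paired with X are those of N⁻(X) ∖ U, and U ⊆ N⁻(X).
commonOut-doubleCount : ∀ {p q} (D : Digraph n) (U : Subset n) → ∣ U ∣ ≡ s →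
  OutLiking (suc s) p D → OutLiking m q (reverse D) →
  (n ∸ s) * (p C m) ≡ (∣ commonOut D U ∣ C m) * (q ∸ s)
commonOut-doubleCount {n} {m = m} {p} {q} D U refl liking⁺ liking⁻ = begin
  (n ∸ ∣ U ∣) * (p C m)                             ≡⟨ cong (_* (p C m)) ∣∁U∣≡∑ ⟩
  (∑[ u < n ] 𝟙 (u ∈? ∁ U)) * (p C m)               ≡⟨ *-distribʳ-sum (p C m) (λ u → 𝟙 (u ∈? ∁ U)) ⟩
  ∑[ u < n ] (𝟙 (u ∈? ∁ U) * (p C m))               ≡⟨ sum-cong-≗ byVertex ⟨
  ∑[ u < n ] sumSubsets (λ X → 𝟙 (Incident? u X))   ≡⟨ ∑-sumSubsets-comm (λ u X → 𝟙 (Incident? u X)) ⟩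
  sumSubsets (λ X → ∑[ u < n ] 𝟙 (Incident? u X))   ≡⟨ sumSubsets-cong bySubset ⟩
  sumSubsets (λ X → 𝟙 (OfSize? X) * (q ∸ ∣ U ∣))    ≡⟨ *-distribʳ-sumSubsets (q ∸ ∣ U ∣) (λ X → 𝟙 (OfSize? X)) ⟨
  sumSubsets (λ X → 𝟙 (OfSize? X)) * (q ∸ ∣ U ∣)    ≡⟨ cong (_* (q ∸ ∣ U ∣)) (sumSubsets-ofSize≡C N⁺ m) ⟩
  (∣ N⁺ ∣ C m) * (q ∸ ∣ U ∣)                         ∎
  where
  open ≡-Reasoning
  N⁺ = commonOut D U

  ∣∁U∣≡∑ : n ∸ ∣ U ∣ ≡ ∑[ u < n ] 𝟙 (u ∈? ∁ U)
  ∣∁U∣≡∑ = trans (sym (∣∁p∣≡n∸∣p∣ U)) (∣p∣≡∑𝟙∈ (∁ U))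

  OfSize? : ∀ X → Dec (X ⊆ N⁺ × ∣ X ∣ ≡ m)
  OfSize? X = (X ⊆? N⁺) ×-dec (∣ X ∣ ≟ m)

  Incident? : ∀ u X → Dec (u ∈ ∁ U × (X ⊆ commonOut D (U ∪ ⁅ u ⁆) × ∣ X ∣ ≡ m))
  Incident? u X = (u ∈? ∁ U) ×-dec ((X ⊆? commonOut D (U ∪ ⁅ u ⁆)) ×-dec (∣ X ∣ ≟ m))

  transpose : ∀ {u X} → (u ∈ ∁ U × (X ⊆ commonOut D (U ∪ ⁅ u ⁆) × ∣ X ∣ ≡ m)) ⇔
                        ((X ⊆ N⁺ × ∣ X ∣ ≡ m) × u ∈ ∁ U ∩ commonIn D X)
  transpose {u} {X} = mk⇔
    (λ (u∉U , X⊆ , ∣X∣≡m) → let X⊆N⁺ , X⊆N⁺u = to ⊆-∩⇔ (subst (X ⊆_) (commonOut-∪⁅⁆ D U u) X⊆) in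
       (X⊆N⁺ , ∣X∣≡m) , x∈p∩q⁺ (u∉U , to (⊆-outNbrs⇔∈-commonIn D) X⊆N⁺u))
    (λ ((X⊆N⁺ , ∣X∣≡m) , u∈) → let u∉U , u∈N⁻X = x∈p∩q⁻ _ _ u∈ in
       u∉U , subst (X ⊆_) (sym (commonOut-∪⁅⁆ D U u))
                           (from ⊆-∩⇔ (X⊆N⁺ , from (⊆-outNbrs⇔∈-commonIn D) u∈N⁻X)) , ∣X∣≡m)

  byVertex : ∀ u → sumSubsets (λ X → 𝟙 (Incident? u X)) ≡ 𝟙 (u ∈? ∁ U) * (p C m)
  byVertex u = begin
    sumSubsets (λ X → 𝟙 (Incident? u X))
      ≡⟨ sumSubsets-cong (λ X → 𝟙-×-dec (u ∈? ∁ U) ((X ⊆? N⁺u) ×-dec (∣ X ∣ ≟ m))) ⟩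
    sumSubsets (λ X → 𝟙 (u ∈? ∁ U) * 𝟙 ((X ⊆? N⁺u) ×-dec (∣ X ∣ ≟ m)))
      ≡⟨ *-distribˡ-sumSubsets (𝟙 (u ∈? ∁ U)) (λ X → 𝟙 ((X ⊆? N⁺u) ×-dec (∣ X ∣ ≟ m))) ⟨
    𝟙 (u ∈? ∁ U) * sumSubsets (λ X → 𝟙 ((X ⊆? N⁺u) ×-dec (∣ X ∣ ≟ m)))
      ≡⟨ cong (𝟙 (u ∈? ∁ U) *_) (sumSubsets-ofSize≡C N⁺u m) ⟩
    𝟙 (u ∈? ∁ U) * (∣ N⁺u ∣ C m)
      ≡⟨ 𝟙*-cong (u ∈? ∁ U) (cong (_C m) ∘ ∣N⁺u∣≡p) ⟩
    𝟙 (u ∈? ∁ U) * (p C m) ∎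
    where
    N⁺u = commonOut D (U ∪ ⁅ u ⁆)
    ∣N⁺u∣≡p : u ∈ ∁ U → ∣ N⁺u ∣ ≡ p
    ∣N⁺u∣≡p u∈∁U = liking⁺ (U ∪ ⁅ u ⁆) (∣p∪⁅x⁆∣≡1+∣p∣ (x∈∁p⇒x∉p u∈∁U))

  bySubset : ∀ X → ∑[ u < n ] 𝟙 (Incident? u X) ≡ 𝟙 (OfSize? X) * (q ∸ ∣ U ∣)
  bySubset X = begin
    ∑[ u < n ] 𝟙 (Incident? u X)
      ≡⟨ sum-cong-≗ (λ u → trans (𝟙-cong transpose (Incident? u X) (OfSize? X ×-dec (u ∈? N⁻)))
                                 (𝟙-×-dec (OfSize? X) (u ∈? N⁻))) ⟩
    ∑[ u < n ] (𝟙 (OfSize? X) * 𝟙 (u ∈? N⁻))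
      ≡⟨ *-distribˡ-sum (𝟙 (OfSize? X)) (λ u → 𝟙 (u ∈? N⁻)) ⟨
    𝟙 (OfSize? X) * ∑[ u < n ] 𝟙 (u ∈? N⁻)
      ≡⟨ cong (𝟙 (OfSize? X) *_) (∣p∣≡∑𝟙∈ N⁻) ⟨
    𝟙 (OfSize? X) * ∣ N⁻ ∣
      ≡⟨ 𝟙*-cong (OfSize? X) ∣N⁻∣≡q∸s ⟩
    𝟙 (OfSize? X) * (q ∸ ∣ U ∣) ∎
    where
    N⁻ = ∁ U ∩ commonIn D X
    ∣N⁻∣≡q∸s : X ⊆ N⁺ × ∣ X ∣ ≡ m → ∣ N⁻ ∣ ≡ q ∸ ∣ U ∣
    ∣N⁻∣≡q∸s (X⊆N⁺ , ∣X∣≡m) =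
      trans (∣∁q∩p∣≡∣p∣∸∣q∣ {q = U} (⊆-commonOut⇒⊆-commonIn D X⊆N⁺)) (cong (_∸ ∣ U ∣) (liking⁻ X ∣X∣≡m))

TwoWayLiking-pred : ∀ {a} (D : Digraph n) → s < n → s < a → TwoWayLiking (suc s) a D →
  Σ ℕ (λ b → s < b × TwoWayLiking s b D)
TwoWayLiking-pred {n} {s} {a} D s<n s<a liking =
  b , solution>s solves-b , λ U ∣U∣≡s →
    solutions-unique (solves D liking U ∣U∣≡s) solves-b ,
    solutions-unique (solves (reverse D) (TwoWayLiking-reverse D liking) U ∣U∣≡s) solves-b
  where
  Solves : ℕ → Set
  Solves x = (n ∸ s) * (a C suc s) ≡ (x C suc s) * (a ∸ s)

  solves : (D′ : Digraph n) → TwoWayLiking (suc s) a D′ → ∀ U → ∣ U ∣ ≡ s → Solves ∣ commonOut D′ U ∣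
  solves D′ liking′ U ∣U∣≡s =
    commonOut-doubleCount D′ U ∣U∣≡s (TwoWayLiking⇒OutLiking D′ liking′) (TwoWayLiking⇒InLiking D′ liking′)

  solution>s : ∀ {x} → Solves x → s < x
  solution>s solves-x = ≮⇒≥ λ x<1+s →
    n>0⇒n≢0 (*-mono-< (m<n⇒0<n∸m s<n) (k≤n⇒nCk>0 s<a))
            (trans solves-x (cong (_* (a ∸ s)) (k>n⇒nCk≡0 x<1+s)))

  solutions-unique : ∀ {x y} → Solves x → Solves y → x ≡ y
  solutions-unique solves-x solves-y =
    C-injectiveˡ (<⇒≤ (solution>s solves-x)) (<⇒≤ (solution>s solves-y))
      (*-cancelʳ-≡ _ _ (a ∸ s) {{>-nonZero (m<n⇒0<n∸m s<a)}} (trans (sym solves-x) solves-y))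

  U₀ = proj₁ (subsetOfSize s (<⇒≤ s<n))
  b = ∣ commonOut D U₀ ∣
  solves-b = solves D liking U₀ (proj₂ (subsetOfSize s (<⇒≤ s<n)))

TwoWayLiking⇒TwoWayLiking₁ : ∀ {a} (D : Digraph n) → s < n → s < a → TwoWayLiking (suc s) a D →
  Σ ℕ (λ k → 0 < k × TwoWayLiking 1 k D)
TwoWayLiking⇒TwoWayLiking₁ {s = zero}  {a} D _   0<a liking = a , 0<a , liking
TwoWayLiking⇒TwoWayLiking₁ {s = suc s}     D s<n s<a liking =
  let b , s<b , liking′ = TwoWayLiking-pred D s<n s<a liking in
  TwoWayLiking⇒TwoWayLiking₁ D (<⇒≤ s<n) (<⇒≤ s<b) liking′

OutLiking₁⇒outDegree : (D : Digraph n) → OutLiking 1 k D → ∀ v → ∣ outNbrs D v ∣ ≡ k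
OutLiking₁⇒outDegree D liking v = trans (cong ∣_∣ (sym (commonOut-⁅⁆ D v))) (liking ⁅ v ⁆ (∣⁅x⁆∣≡1 v))

TwoWayLiking₁⇒Diregular : (D : Digraph n) → TwoWayLiking 1 k D → Diregular k D
TwoWayLiking₁⇒Diregular D liking v =
  OutLiking₁⇒outDegree D (TwoWayLiking⇒OutLiking D liking) v ,
  OutLiking₁⇒outDegree (reverse D) (TwoWayLiking⇒InLiking D liking) v

lemma3p2 : (t l n : ℕ) → 2 ≤ t → t ≤ l → t ≤ n → (D : Digraph n) → TwoWayLiking t l D →
    Σ ℕ (λ k → (k > 0) × Diregular k D ×
      (((n ∸ 1) C (t ∸ 1)) * (l C t) ≡ (k C t) * ((l ∸ 1) C (t ∸ 1))))
lemma3p2 (suc t) l n (s≤s _) t<l t<n D liking =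
  let k , k>0 , liking₁ = TwoWayLiking⇒TwoWayLiking₁ D t<n t<l liking
      counted = commonOut-doubleCount D ⊥ (∣⊥∣≡0 n)
                  (TwoWayLiking⇒OutLiking D liking₁) (TwoWayLiking⇒InLiking D liking)
      ∣N⁺⊥∣≡n = trans (cong ∣_∣ (commonOut-⊥ D)) (∣⊤∣≡n n)
  in k , k>0 , TwoWayLiking₁⇒Diregular D liking₁ ,
     n*kCt≡nCt*l⇒[n∸1]C[t∸1]*lCt≡kCt*[l∸1]C[t∸1] k (<-≤-trans z<s t<n) z<s (<-≤-trans z<s t<l)
       (subst (λ c → n * (k C suc t) ≡ (c C suc t) * l) ∣N⁺⊥∣≡n counted)
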